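{- Let $C$ be an ACA with input alphabet $\Sigma$, and let $w\in\Sigma^+$ be an input which $C$ accepts in exactly $\tau$ steps. Then for every input $w'\in\Sigma^+$ such that $p_{2\tau}(w) = p_{2\tau}(w')$, $I_{2\tau+1}(w') \subseteq I_{2\tau+1}(w)$, and $s_{2\tau}(w) = s_{2\tau}(w')$, $C$ accepts $w'$ in at most $\tau$ steps.
   Context: A cellular automaton (CA) is $C=(Q,\delta,\Sigma)$ with finite state set $Q$, local rule $\delta\colon Q^3\to Q$, input alphabet $\Sigma\subseteq Q$, and an inactive state $q\in Q\setminus\Sigma$ with $\delta(z_1,z_2,z_3)=q$ iff $z_2=q$; the global map is $\Delta(c)(z)=\delta(c(z-1),c(z),c(z+1))$ on $Q^{\mathbb{Z}}$. For input $w\in\Sigma^+$ the initial configuration has $c_0(i)=w(i)$ for $0\le i<|w|$ and $q$ elsewhere. An ACA additionally has a nonempty set $A\subseteq Q\setminus\{q\}$ of accept states; it accepts $w$ if some $\Delta^\tau(c_0)$ has all cells in $A\cup\{q\}$, and the least such $\tau$ is the number of steps in which it accepts $w$. For a word $w$ and $k\in\mathbb{N}_0$, $p_k(w)$, $s_k(w)$, $I_k(w)$ denote the prefix of length $k$, the suffix of length $k$, and the set of infixes (contiguous substrings) of length $k$ of $w$, with $p_k(w)=s_k(w)=w$ and $I_k(w)=\{w\}$ whenever $k\ge|w|$. -}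

module Defs where

open import Data.Nat using (ℕ; zero; suc; _≤_; _<_; _∸_)
open import Data.Integer using (ℤ; +_; -[1+_]; _+_; _-_; 1ℤ)
open import Data.Fin using (Fin)
open import Data.Fin.Subset using (Subset; _∈_; _∉_; Nonempty)
open import Data.List using (List; []; _∷_; length; take; drop; _++_)
open import Data.List.Relation.Unary.All using (All)
open import Data.Product using (Σ; ∃; ∃-syntax; _×_; _,_)
open import Data.Sum using (_⊎_)
open import Relation.Binary.PropositionalEquality using (_≡_)
open import Relation.Nullary using (¬_)
open import Function.Bundles using (_⇔_)

record ACA : Set where
  field
    n        : ℕ
    δ        : Fin n → Fin n → Fin n → Fin n
    Sig      : Subset n
    q        : Fin n
    q∉Sig    : q ∉ Sig
    quiesc   : ∀ z₁ z₂ z₃ → (δ z₁ z₂ z₃ ≡ q) ⇔ (z₂ ≡ q)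
    Acc      : Subset n
    q∉Acc    : q ∉ Acc
    Acc-ne   : Nonempty Acc

module _ (C : ACA) where
  open ACA C

  Config : Set
  Config = ℤ → Fin n

  Δ : Config → Config
  Δ c z = δ (c (z - 1ℤ)) (c z) (c (z + 1ℤ))

  Δ^ : ℕ → Config → Config
  Δ^ zero    c = c
  Δ^ (suc t) c = Δ (Δ^ t c)

  Word : Set
  Word = List (Fin n)

  IsInput : Word → Set
  IsInput w = All (_∈ Sig) w × ¬ (w ≡ [])

  cellOf : Word → ℕ → Fin n
  cellOf []      _       = q
  cellOf (a ∷ w) zero    = a
  cellOf (a ∷ w) (suc i) = cellOf w i

  init : Word → Config
  init w (+ i)      = cellOf w i
  init w -[1+ _ ]   = q

  AllAccepting : Config → Set
  AllAccepting c = ∀ z → c z ∈ Acc ⊎ c z ≡ q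

  AcceptsAt : Word → ℕ → Set
  AcceptsAt w t = AllAccepting (Δ^ t (init w))

  AcceptsInExactly : Word → ℕ → Set
  AcceptsInExactly w τ = AcceptsAt w τ × (∀ t → t < τ → ¬ AcceptsAt w t)

  AcceptsInAtMost : Word → ℕ → Set
  AcceptsInAtMost w τ = ∃[ t ] (t ≤ τ × AcceptsAt w t)

-- prefix / suffix of length k (the whole word when k ≥ |w|)
pre : {X : Set} → ℕ → List X → List X
pre k w = take k w

suf : {X : Set} → ℕ → List X → List X
suf k w = drop (length w ∸ k) w

InfixOf : {X : Set} → ℕ → List X → List X → Set
InfixOf k w u = (length w ≤ k × u ≡ w)
              ⊎ (k < length w × length u ≡ k × ∃[ l ] ∃[ r ] w ≡ l ++ u ++ r)

InfixesSub : {X : Set} → ℕ → List X → List X → Set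
InfixesSub k w' w = ∀ u → InfixOf k w' u → InfixOf k w u

-- A cell's state after τ steps depends only on the 2τ+1 initial cells around it (light-cone
-- locality), and the inactive state q never changes. Every radius-τ neighbourhood of a cell
-- of w' occurs in w: near the left end it lies in the common prefix (or the common inactive
-- region), near the right end in the common suffix, and otherwise it is an infix of w' of
-- length 2τ+1, hence an infix of w. So after τ steps every cell at a nonnegative position
-- copies a cell of the accepting configuration reached from w.
module Submission where

open import Defs
open import Data.Nat using (ℕ; zero; suc; _+_; _*_; _⊓_; _≤_; _<_; _∸_; z≤n; s≤s; _<?_)
import Data.Nat.Properties as ℕ
open import Data.Integer as ℤ using (ℤ; +_; -[1+_]; 1ℤ; 0ℤ; +<+)
import Data.Integer.Properties as ℤ
open import Data.Integer.Tactic.RingSolver using (solve-∀)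
open import Data.Nat.Tactic.RingSolver renaming (solve-∀ to ℕ-solve-∀)
open import Data.List using (List; []; _∷_; length; take; drop; _++_)
open import Data.List.Properties using (take-all; length-take; length-drop; take++drop≡id)
open import Data.Product using (∃-syntax; _×_; _,_)
open import Data.Sum using (_⊎_; inj₁; inj₂)
open import Data.Fin.Subset using (_∈_)
open import Function.Bundles using (Equivalence)
open import Relation.Nullary using (yes; no)
open import Relation.Binary.PropositionalEquality
  using (_≡_; refl; sym; trans; cong; subst; module ≡-Reasoning)
open ≡-Reasoning

module _ {X : Set} where

  infix-take-drop : ∀ k a (xs : List X) → a + k ≤ length xs →
                    InfixOf k xs (take k (drop a xs))
  infix-take-drop k a xs a+k≤ with k <? length xs
  ... | yes k< = inj₂ (k< , length-window , take a xs , drop k (drop a xs) , decomposition)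
    where
      length-window : length (take k (drop a xs)) ≡ k
      length-window = begin
        length (take k (drop a xs))  ≡⟨ length-take k (drop a xs) ⟩
        k ⊓ length (drop a xs)       ≡⟨ cong (k ⊓_) (length-drop a xs) ⟩
        k ⊓ (length xs ∸ a)          ≡⟨ ℕ.m≤n⇒m⊓n≡m (ℕ.m+n≤o⇒m≤o∸n k (subst (_≤ length xs) (ℕ.+-comm a k) a+k≤)) ⟩
        k                            ∎
      decomposition : xs ≡ take a xs ++ (take k (drop a xs) ++ drop k (drop a xs))
      decomposition = sym (begin
        take a xs ++ (take k (drop a xs) ++ drop k (drop a xs)) ≡⟨ cong (take a xs ++_) (take++drop≡id k (drop a xs)) ⟩
        take a xs ++ drop a xs                                  ≡⟨ take++drop≡id a xs ⟩
        xs                                                      ∎)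
  ... | no k≮ = inj₁ (|xs|≤k , subst (λ a → take k (drop a xs) ≡ xs) (sym a≡0) (take-all k xs |xs|≤k))
    where
      |xs|≤k : length xs ≤ k
      |xs|≤k = ℕ.≮⇒≥ k≮
      a≡0 : a ≡ 0
      a≡0 = ℕ.n≤0⇒n≡0 (ℕ.+-cancelʳ-≤ k a 0 (ℕ.≤-trans a+k≤ |xs|≤k))

module _ (C : ACA) where
  open ACA C

  Δ^-inactive : ∀ t (c : Config C) z → c z ≡ q → Δ^ C t c z ≡ q
  Δ^-inactive zero    c z cz≡q = cz≡q
  Δ^-inactive (suc t) c z cz≡q = Equivalence.from (quiesc _ _ _) (Δ^-inactive t c z cz≡q)

  SameWindow : ℕ → Config C → ℤ → Config C → ℤ → Set
  SameWindow t c a c' b = ∀ d → d ≤ 2 * t → c (a ℤ.+ + d) ≡ c' (b ℤ.+ + d)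

  SameWindow-narrow : ∀ {t c c' a b} k → k ≤ 2 → SameWindow (suc t) c a c' b →
                      SameWindow t c (a ℤ.+ + k) c' (b ℤ.+ + k)
  SameWindow-narrow {t} {c} {c'} {a} {b} k k≤2 same d d≤ = begin
    c ((a ℤ.+ + k) ℤ.+ + d)  ≡⟨ cong c (ℤ.+-assoc a (+ k) (+ d)) ⟩
    c (a ℤ.+ + (k + d))      ≡⟨ same (k + d) k+d≤ ⟩
    c' (b ℤ.+ + (k + d))     ≡⟨ cong c' (sym (ℤ.+-assoc b (+ k) (+ d))) ⟩
    c' ((b ℤ.+ + k) ℤ.+ + d) ∎
    where
      k+d≤ : k + d ≤ 2 * suc t
      k+d≤ = subst (k + d ≤_) (sym (ℕ.*-suc 2 t)) (ℕ.+-mono-≤ k≤2 d≤)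

  Δ-cong : ∀ {c c' : Config C} {z z'} →
           c (z ℤ.- 1ℤ) ≡ c' (z' ℤ.- 1ℤ) → c z ≡ c' z' → c (z ℤ.+ 1ℤ) ≡ c' (z' ℤ.+ 1ℤ) →
           Δ C c z ≡ Δ C c' z'
  Δ-cong left centre right rewrite left | centre | right = refl

  Δ^-local : ∀ t {c c' a b} → SameWindow t c a c' b →
             Δ^ C t c (a ℤ.+ + t) ≡ Δ^ C t c' (b ℤ.+ + t)
  Δ^-local zero    same = same 0 z≤n
  Δ^-local (suc t) {c} {c'} {a} {b} same =
    Δ-cong {Δ^ C t c} {Δ^ C t c'} (window-centre 0 z≤n (left a) (left b))
           (window-centre 1 (s≤s z≤n) (centre a) (centre b))
           (window-centre 2 ℕ.≤-refl (right a) (right b))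
    where
      -- The neighbours of cell a + (t + 1) are the centres of the windows starting at a, a + 1, a + 2.
      window-centre : ∀ k → k ≤ 2 → ∀ {z z'} →
                      z ≡ (a ℤ.+ + k) ℤ.+ + t → z' ≡ (b ℤ.+ + k) ℤ.+ + t →
                      Δ^ C t c z ≡ Δ^ C t c' z'
      window-centre k k≤2 refl refl =
        Δ^-local t {a = a ℤ.+ + k} {b ℤ.+ + k} (SameWindow-narrow {t} {c} {c'} {a} {b} k k≤2 same)
      left : ∀ a → a ℤ.+ + suc t ℤ.- 1ℤ ≡ (a ℤ.+ 0ℤ) ℤ.+ + t
      left a = shuffle a (+ t)
        where shuffle : ∀ a x → a ℤ.+ (1ℤ ℤ.+ x) ℤ.- 1ℤ ≡ (a ℤ.+ 0ℤ) ℤ.+ x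
              shuffle = solve-∀
      centre : ∀ a → a ℤ.+ + suc t ≡ (a ℤ.+ 1ℤ) ℤ.+ + t
      centre a = sym (ℤ.+-assoc a 1ℤ (+ t))
      right : ∀ a → a ℤ.+ + suc t ℤ.+ 1ℤ ≡ (a ℤ.+ + 2) ℤ.+ + t
      right a = shuffle a (+ t)
        where shuffle : ∀ a x → a ℤ.+ (1ℤ ℤ.+ x) ℤ.+ 1ℤ ≡ (a ℤ.+ + 2) ℤ.+ x
              shuffle = solve-∀

  cellOf-take : ∀ k xs j → j < k → cellOf C (take k xs) j ≡ cellOf C xs j
  cellOf-take (suc k) []       j       _         = refl
  cellOf-take (suc k) (x ∷ xs) zero    _         = refl
  cellOf-take (suc k) (x ∷ xs) (suc j) (s≤s j<k) = cellOf-take k xs j j<k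

  cellOf-drop : ∀ k xs j → cellOf C (drop k xs) j ≡ cellOf C xs (k + j)
  cellOf-drop zero    xs       j = refl
  cellOf-drop (suc k) []       j = refl
  cellOf-drop (suc k) (x ∷ xs) j = cellOf-drop k xs j

  cellOf-++ʳ : ∀ l v j → cellOf C (l ++ v) (length l + j) ≡ cellOf C v j
  cellOf-++ʳ []      v j = refl
  cellOf-++ʳ (x ∷ l) v j = cellOf-++ʳ l v j

  cellOf-++ˡ : ∀ u r j → j < length u → cellOf C (u ++ r) j ≡ cellOf C u j
  cellOf-++ˡ (x ∷ u) r zero    _         = refl
  cellOf-++ˡ (x ∷ u) r (suc j) (s≤s j<u) = cellOf-++ˡ u r j j<u

  cellOf-drop-shift : ∀ {xs ys} s s' → drop s xs ≡ drop s' ys →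
                      ∀ e → cellOf C xs (s + e) ≡ cellOf C ys (s' + e)
  cellOf-drop-shift {xs} {ys} s s' eq e = begin
    cellOf C xs (s + e)      ≡⟨ sym (cellOf-drop s xs e) ⟩
    cellOf C (drop s xs) e   ≡⟨ cong (λ v → cellOf C v e) eq ⟩
    cellOf C (drop s' ys) e  ≡⟨ cellOf-drop s' ys e ⟩
    cellOf C ys (s' + e)     ∎

  init-take : ∀ {w w'} k → take k w ≡ take k w' → ∀ z → z ℤ.< + k → init C w z ≡ init C w' z
  init-take         k eq -[1+ _ ] _          = refl
  init-take {w} {w'} k eq (+ j)    (+<+ j<k) = begin
    cellOf C w j            ≡⟨ sym (cellOf-take k w j j<k) ⟩
    cellOf C (take k w) j   ≡⟨ cong (λ v → cellOf C v j) eq ⟩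
    cellOf C (take k w') j  ≡⟨ cellOf-take k w' j j<k ⟩
    cellOf C w' j           ∎

  InfixOf-offset : ∀ {k w u} → InfixOf k w u →
                   ∃[ b ] (∀ d → d < k → cellOf C u d ≡ cellOf C w (b + d))
  InfixOf-offset (inj₁ (_ , refl)) = 0 , λ _ _ → refl
  InfixOf-offset {u = u} (inj₂ (_ , |u|≡k , l , r , refl)) = length l , λ d d<k → begin
    cellOf C u d                           ≡⟨ sym (cellOf-++ˡ u r d (subst (d <_) (sym |u|≡k) d<k)) ⟩
    cellOf C (u ++ r) d                    ≡⟨ sym (cellOf-++ʳ l (u ++ r) d) ⟩
    cellOf C (l ++ u ++ r) (length l + d) ∎

module _ (C : ACA) {w w' : Word C} {τ : ℕ}
         (same-prefix : pre (2 * τ) w ≡ pre (2 * τ) w')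
         (fewer-infixes : InfixesSub (suc (2 * τ)) w' w)
         (same-suffix : suf (2 * τ) w ≡ suf (2 * τ) w') where

  WindowOccurs : ℕ → Set
  WindowOccurs i = ∃[ a ] ∃[ b ] (a ℤ.+ + τ ≡ + i × SameWindow C τ (init C w') a (init C w) b)

  prefix-window : ∀ i → i < τ → WindowOccurs i
  prefix-window i i<τ = a , a , centre , λ d d≤ →
    init-take C (2 * τ) (sym same-prefix) (a ℤ.+ + d) (ℤ.≤-<-trans (ℤ.+-monoʳ-≤ a (ℤ.+≤+ d≤)) end<)
    where
      a : ℤ
      a = + i ℤ.- + τ
      centre : a ℤ.+ + τ ≡ + i
      centre = shuffle (+ i) (+ τ)
        where shuffle : ∀ x y → x ℤ.- y ℤ.+ y ≡ x
              shuffle = solve-∀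
      end< : a ℤ.+ + (2 * τ) ℤ.< + (2 * τ)
      end< = subst (ℤ._< + (2 * τ)) (sym (shuffle (+ i) (+ τ)))
                 (+<+ (subst (i + τ <_) (cong (_+_ τ) (sym (ℕ.+-identityʳ τ))) (ℕ.+-monoˡ-< τ i<τ)))
        -- + (2 * τ) unfolds to + τ ℤ.+ (+ τ ℤ.+ + 0).
        where shuffle : ∀ x y → x ℤ.- y ℤ.+ (y ℤ.+ (y ℤ.+ 0ℤ)) ≡ x ℤ.+ y
              shuffle = solve-∀

  suffix-window : ∀ i → τ ≤ i → length w' ≤ i + τ → WindowOccurs i
  suffix-window i τ≤i w'≤i+τ = + a , + (s + (a ∸ s')) , cong +_ a+τ≡i , λ d _ → begin
    cellOf C w' (a + d)             ≡⟨ cong (cellOf C w') (sym (a+d≡ d)) ⟩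
    cellOf C w' (s' + (a ∸ s' + d)) ≡⟨ cellOf-drop-shift C s' s (sym same-suffix) (a ∸ s' + d) ⟩
    cellOf C w (s + (a ∸ s' + d))   ≡⟨ cong (cellOf C w) (sym (ℕ.+-assoc s (a ∸ s') d)) ⟩
    cellOf C w (s + (a ∸ s') + d)   ∎
    where
      a s s' : ℕ
      a  = i ∸ τ
      s  = length w ∸ 2 * τ
      s' = length w' ∸ 2 * τ
      a+τ≡i : a + τ ≡ i
      a+τ≡i = ℕ.m∸n+n≡m τ≤i
      s'≤a : s' ≤ a
      s'≤a = ℕ.m≤n+o⇒m∸n≤o (length w') (2 * τ)
               (subst (length w' ≤_) (trans (cong (_+ τ) (sym a+τ≡i)) (swap a τ)) w'≤i+τ)
        where swap : ∀ a τ → a + τ + τ ≡ 2 * τ + a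
              swap = ℕ-solve-∀
      a+d≡ : ∀ d → s' + (a ∸ s' + d) ≡ a + d
      a+d≡ d = trans (sym (ℕ.+-assoc s' (a ∸ s') d)) (cong (_+ d) (ℕ.m+[n∸m]≡n s'≤a))

  infix-window : ∀ i → τ ≤ i → i + τ < length w' → WindowOccurs i
  infix-window i τ≤i i+τ<w' =
    from-offset (InfixOf-offset C (fewer-infixes u (infix-take-drop (suc (2 * τ)) a w' fits)))
    where
      a : ℕ
      a = i ∸ τ
      u : Word C
      u = take (suc (2 * τ)) (drop a w')
      a+τ≡i : a + τ ≡ i
      a+τ≡i = ℕ.m∸n+n≡m τ≤i
      fits : a + suc (2 * τ) ≤ length w'
      fits = subst (_≤ length w') (trans (cong (λ x → suc (x + τ)) (sym a+τ≡i)) (swap a τ)) i+τ<w'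
        where swap : ∀ a τ → suc (a + τ + τ) ≡ a + suc (2 * τ)
              swap = ℕ-solve-∀
      from-offset : ∃[ b ] (∀ d → d < suc (2 * τ) → cellOf C u d ≡ cellOf C w (b + d)) → WindowOccurs i
      from-offset (b , offset) = + a , + b , cong +_ a+τ≡i , λ d d≤ → begin
        cellOf C w' (a + d)     ≡⟨ sym (cellOf-drop C a w' d) ⟩
        cellOf C (drop a w') d  ≡⟨ sym (cellOf-take C (suc (2 * τ)) (drop a w') d (s≤s d≤)) ⟩
        cellOf C u d            ≡⟨ offset d (s≤s d≤) ⟩
        cellOf C w (b + d)      ∎

  window-occurs : ∀ i → WindowOccurs i
  window-occurs i with i <? τ | i + τ <? length w'
  ... | yes i<τ | _          = prefix-window i i<τ
  ... | no i≮τ  | yes i+τ<w' = infix-window i (ℕ.≮⇒≥ i≮τ) i+τ<w'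
  ... | no i≮τ  | no i+τ≮w'  = suffix-window i (ℕ.≮⇒≥ i≮τ) (ℕ.≮⇒≥ i+τ≮w')

lemma1 : (C : ACA) (w : Word C) (τ : ℕ) → IsInput C w → AcceptsInExactly C w τ →
         (w' : Word C) → IsInput C w' →
         pre (2 * τ) w ≡ pre (2 * τ) w' →
         InfixesSub (suc (2 * τ)) w' w →
         suf (2 * τ) w ≡ suf (2 * τ) w' →
         AcceptsInAtMost C w' τ
lemma1 C w τ _ (accepts , _) w' _ same-prefix fewer-infixes same-suffix = τ , ℕ.≤-refl , accepts'
  where
    open ACA C
    accepts' : AcceptsAt C w' τ
    accepts' -[1+ k ] = inj₂ (Δ^-inactive C τ (init C w') -[1+ k ] refl)
    accepts' (+ i) with window-occurs C {w} {w'} {τ} same-prefix fewer-infixes same-suffix i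
    ... | a , b , a+τ≡i , same = subst (λ x → x ∈ Acc ⊎ x ≡ q) (sym copies) (accepts (b ℤ.+ + τ))
      where
        copies : Δ^ C τ (init C w') (+ i) ≡ Δ^ C τ (init C w) (b ℤ.+ + τ)
        copies = trans (cong (Δ^ C τ (init C w')) (sym a+τ≡i)) (Δ^-local C τ {a = a} {b = b} same)
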